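{- Let $P$ be a connected finite $\Gamma$-colored $d$-complete poset. Then its top tree $T$ is connected (as a subposet of $P$).
   Context: Dynkin diagram $\Gamma$: finite set with integers $\theta_{ab}$, $\theta_{aa}=2$, $\theta_{ab}\le0$ ($a\ne b$), $\theta_{ab}=0\iff\theta_{ba}=0$; $a\sim b$ if $a\ne b$ and $\theta_{ab}<0$. $\Gamma$-colored poset: poset with surjective $\kappa:P\to\Gamma$. Consecutive elements of color $a$: $x<y$ of color $a$, no color-$a$ element in $(x,y)$. $U(x,P)=\{y>x:\kappa(y)\sim\kappa(x)\}$. $\Gamma$-colored $d$-complete: locally finite with (EC) equal colors comparable; (NA) neighbors (one covers the other) have adjacent colors; (AC) adjacent colors comparable; (ICE2) consecutive $x<y$ of color $a$ have $\sum_{z\in(x,y)}-\theta_{\kappa(z),a}=2$; (UCB1) for maximal $x$ of color $a$, $U(x,P)$ finite and $\sum_{y\in U(x,P)}-\theta_{\kappa(y),a}\le1$. The top tree $T$ of finite $P$ is the set of elements maximal among elements of their color. A poset is connected if it is not a disjoint union of two nonempty subposets (with no relations between them). -}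

module Defs where

open import Data.Nat using (ℕ)
open import Data.Fin using (Fin)
open import Data.Fin.Properties using () renaming (_≟_ to _≟ᶠ_)
open import Data.Integer using (ℤ; +_; -_; 0ℤ) renaming (_<_ to _<ℤ_; _≤_ to _≤ℤ_)
open import Data.Integer.Properties using () renaming (_<?_ to _<ℤ?_)
open import Data.List using (List; map; allFin)
import Data.Integer
open import Data.Product using (Σ; _×_; ∃; ∃-syntax; _,_)
open import Data.Sum using (_⊎_)
open import Data.Unit using (⊤)
open import Data.Bool using (Bool; true; false)
open import Relation.Nullary using (¬_; Dec; yes; no)
open import Relation.Nullary.Decidable using (_×-dec_; ¬?)
open import Relation.Binary.PropositionalEquality using (_≡_; _≢_)
open import Relation.Binary.Structures using (IsPartialOrder)
open import Relation.Binary.Definitions using (Decidable)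

sumℤ : List ℤ → ℤ
sumℤ = Data.List.foldr Data.Integer._+_ 0ℤ

record Dynkin (m : ℕ) : Set where
  field
    θ       : Fin m → Fin m → ℤ
    θ-diag  : ∀ a → θ a a ≡ + 2
    θ-nonpos : ∀ a b → a ≢ b → θ a b ≤ℤ 0ℤ
    θ-sym0  : ∀ a b → (θ a b ≡ 0ℤ → θ b a ≡ 0ℤ) × (θ b a ≡ 0ℤ → θ a b ≡ 0ℤ)

  _∼_ : Fin m → Fin m → Set
  a ∼ b = a ≢ b × θ a b <ℤ 0ℤ

  _∼?_ : Decidable _∼_
  a ∼? b = ¬? (a ≟ᶠ b) ×-dec (θ a b <ℤ? 0ℤ)

-- Finite posets on the carrier Fin n (order given with a decision
-- procedure; every relation on a finite set is classically decidable).

record FinPoset (n : ℕ) : Set₁ where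
  field
    _≤_   : Fin n → Fin n → Set
    isPO  : IsPartialOrder _≡_ _≤_
    _≤?_  : Decidable _≤_

  _<_ : Fin n → Fin n → Set
  x < y = x ≤ y × x ≢ y

  _<?_ : Decidable _<_
  x <? y = (x ≤? y) ×-dec ¬? (x ≟ᶠ y)

  _⋖_ : Fin n → Fin n → Set
  x ⋖ y = x < y × (∀ z → ¬ (x < z × z < y))

  Comparable : Fin n → Fin n → Set
  Comparable x y = x ≤ y ⊎ y ≤ x

  -- A subset S (given as a predicate) is connected as a subposet:
  -- it is not the disjoint union of two nonempty subposets with no
  -- relations between them.  A splitting is described by a Boolean
  -- labelling f of the elements of S.
  ConnectedSub : (Fin n → Set) → Set
  ConnectedSub S =
    (f : Fin n → Bool) →
    (∃[ x ] (S x × f x ≡ true)) →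
    (∃[ y ] (S y × f y ≡ false)) →
    ∃[ x ] ∃[ y ] (S x × S y × f x ≡ true × f y ≡ false × Comparable x y)

  Connected : Set
  Connected = ConnectedSub (λ _ → ⊤)

module _ {m n : ℕ} (Γ : Dynkin m) (P : FinPoset n) (κ : Fin n → Fin m) where
  open Dynkin Γ
  open FinPoset P

  intervalSum : Fin n → Fin n → Fin m → ℤ
  intervalSum x y a = sumℤ (map term (allFin n))
    where
    term : Fin n → ℤ
    term z with (x <? z) ×-dec (z <? y)
    ... | yes _ = - θ (κ z) a
    ... | no  _ = 0ℤ

  upperSum : Fin n → ℤ
  upperSum x = sumℤ (map term (allFin n))
    where
    term : Fin n → ℤ
    term y with (x <? y) ×-dec (κ y ∼? κ x)
    ... | yes _ = - θ (κ y) (κ x)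
    ... | no  _ = 0ℤ

  MaxInColor : Fin n → Set
  MaxInColor x = ∀ y → κ y ≡ κ x → ¬ (x < y)

  record IsDComplete : Set where
    field
      surj : ∀ a → ∃[ x ] κ x ≡ a
      EC   : ∀ x y → κ x ≡ κ y → Comparable x y
      NA   : ∀ x y → x ⋖ y → κ x ∼ κ y
      AC   : ∀ x y → κ x ∼ κ y → Comparable x y
      ICE2 : ∀ x y → x < y → κ x ≡ κ y →
             (∀ z → x < z → z < y → κ z ≢ κ x) →
             intervalSum x y (κ x) ≡ + 2
      UCB1 : ∀ x → MaxInColor x → upperSum x ≤ℤ + 1

  TopTree : Fin n → Set
  TopTree = MaxInColor

-- Every color a has a unique top element top a (it exists by finiteness,
-- and is unique since equal colors are comparable), and the top tree is
-- {top a}.  Label each x by the side of top (κ x) under a splitting f of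
-- the top tree.  As P is connected, some covering pair u ⋖ v carries
-- different labels; u and v have adjacent colors (NA), hence so do
-- top (κ u) and top (κ v), which are therefore comparable (AC) and lie on
-- different sides of f.
module Submission where

open import Defs
open import Data.Nat using (ℕ)
open import Data.Fin using (Fin)
open import Data.Fin.Properties using (any?) renaming (_≟_ to _≟ᶠ_)
open import Data.Fin.Induction using (po-wellFounded; po-noetherian)
open import Data.Bool using (Bool; true; false)
open import Data.Bool.Properties using () renaming (_≟_ to _≟ᵇ_)
open import Data.Product using (_×_; ∃-syntax; _,_)
open import Data.Sum using (inj₁; inj₂; swap)
open import Data.Empty using (⊥-elim)
open import Function using (flip)
open import Induction.WellFounded using (Acc; acc)
open import Relation.Nullary using (yes; no)
open import Relation.Nullary.Decidable using (_×-dec_)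
open import Relation.Binary.Structures using (IsPartialOrder)
open import Relation.Binary.PropositionalEquality
  using (_≡_; _≢_; refl; sym; trans; cong; subst₂; ≢-sym)

module FinPosetProperties {n : ℕ} (P : FinPoset n) where
  open FinPoset P
  open IsPartialOrder isPO using () renaming (refl to ≤-refl; trans to ≤-trans)

  <⇒≤ : ∀ {x y} → x < y → x ≤ y
  <⇒≤ (x≤y , _) = x≤y

  cover-below : ∀ {x y} → x < y → ∃[ z ] (x ⋖ z × z ≤ y)
  cover-below {x} {y} x<y = go y (po-wellFounded isPO y) x<y
    where
    go : ∀ y → Acc _<_ y → x < y → ∃[ z ] (x ⋖ z × z ≤ y)
    go y (acc rs) x<y with any? (λ w → (x <? w) ×-dec (w <? y))
    ... | no ∄w = y , (x<y , λ w x<w<y → ∄w (w , x<w<y)) , ≤-refl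
    ... | yes (w , x<w , w<y) =
      let (z , x⋖z , z≤w) = go w (rs w<y) x<w in z , x⋖z , ≤-trans z≤w (<⇒≤ w<y)

  true-false-differ : ∀ {b c : Bool} → b ≡ true → c ≡ false → b ≢ c
  true-false-differ refl refl ()

  CrossingCover : (Fin n → Bool) → Set
  CrossingCover g = ∃[ u ] ∃[ v ] (u ⋖ v × g u ≢ g v)

  -- Walk up from x along covers: the first cover reaching a new label crosses.
  crossing-cover : ∀ (g : Fin n → Bool) {x y} → x ≤ y → g x ≢ g y → CrossingCover g
  crossing-cover g {x} {y} x≤y gx≢gy = go x (po-noetherian isPO x) x≤y gx≢gy
    where
    go : ∀ x → Acc (flip _<_) x → x ≤ y → g x ≢ g y → CrossingCover g
    go x (acc rs) x≤y gx≢gy with x ≟ᶠ y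
    ... | yes refl = ⊥-elim (gx≢gy refl)
    ... | no x≢y with cover-below (x≤y , x≢y)
    ...   | z , x⋖z@(x<z , _) , z≤y with g x ≟ᵇ g z
    ...     | no gx≢gz = x , z , x⋖z , gx≢gz
    ...     | yes gx≡gz = go z (rs x<z) z≤y (λ gz≡gy → gx≢gy (trans gx≡gz gz≡gy))

  connected⇒crossing-cover : Connected → ∀ (g : Fin n → Bool) →
    ∃[ x ] g x ≡ true → ∃[ y ] g y ≡ false → CrossingCover g
  connected⇒crossing-cover conn g (x₀ , gx₀) (y₀ , gy₀)
    with conn g (x₀ , _ , gx₀) (y₀ , _ , gy₀)
  ... | x , y , _ , _ , gx , gy , inj₁ x≤y = crossing-cover g x≤y (true-false-differ gx gy)
  ... | x , y , _ , _ , gx , gy , inj₂ y≤x = crossing-cover g y≤x (≢-sym (true-false-differ gx gy))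

  SplittingPair : (Fin n → Set) → (Fin n → Bool) → Set
  SplittingPair S f =
    ∃[ x ] ∃[ y ] (S x × S y × f x ≡ true × f y ≡ false × Comparable x y)

  split-pair : ∀ (S : Fin n → Set) (f : Fin n → Bool) {a b} →
    S a → S b → f a ≢ f b → Comparable a b → SplittingPair S f
  split-pair S f {a} {b} Sa Sb fa≢fb a~b with f a in fa | f b in fb
  ... | true  | false = a , b , Sa , Sb , fa , fb , a~b
  ... | false | true  = b , a , Sb , Sa , fb , fa , swap a~b
  ... | true  | true  = ⊥-elim (fa≢fb refl)
  ... | false | false = ⊥-elim (fa≢fb refl)

module TopTreeProperties {m n : ℕ} (Γ : Dynkin m) (P : FinPoset n)
                         (κ : Fin n → Fin m) (D : IsDComplete Γ P κ) where
  open Dynkin Γ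
  open FinPoset P
  open IsDComplete D
  open FinPosetProperties P

  max-in-color-above : ∀ x → ∃[ t ] (κ t ≡ κ x × MaxInColor Γ P κ t)
  max-in-color-above x = go x (po-noetherian isPO x)
    where
    go : ∀ x → Acc (flip _<_) x → ∃[ t ] (κ t ≡ κ x × MaxInColor Γ P κ t)
    go x (acc rs) with any? (λ y → (κ y ≟ᶠ κ x) ×-dec (x <? y))
    ... | no ∄y = x , refl , λ y κy≡κx x<y → ∄y (y , κy≡κx , x<y)
    ... | yes (y , κy≡κx , x<y) =
      let (t , κt≡κy , max-t) = go y (rs x<y) in t , trans κt≡κy κy≡κx , max-t

  top : Fin m → Fin n
  top a = let (x , _) = surj a ; (t , _) = max-in-color-above x in t

  top-color : ∀ a → κ (top a) ≡ a
  top-color a = let (x , κx≡a) = surj a ; (_ , κt≡κx , _) = max-in-color-above x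
                in trans κt≡κx κx≡a

  top-max : ∀ a → MaxInColor Γ P κ (top a)
  top-max a = let (x , _) = surj a ; (_ , _ , max-t) = max-in-color-above x in max-t

  max-in-color⇒top : ∀ t → MaxInColor Γ P κ t → t ≡ top (κ t)
  max-in-color⇒top t max-t with t ≟ᶠ top (κ t) | EC t (top (κ t)) (sym (top-color (κ t)))
  ... | yes t≡top | _          = t≡top
  ... | no t≢top  | inj₁ t≤top = ⊥-elim (max-t _ (top-color (κ t)) (t≤top , t≢top))
  ... | no t≢top  | inj₂ top≤t =
    ⊥-elim (top-max (κ t) t (sym (top-color (κ t))) (top≤t , λ top≡t → t≢top (sym top≡t)))

  cover⇒tops-comparable : ∀ {u v} → u ⋖ v → Comparable (top (κ u)) (top (κ v))
  cover⇒tops-comparable {u} {v} u⋖v =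
    AC _ _ (subst₂ _∼_ (sym (top-color (κ u))) (sym (top-color (κ v))) (NA u v u⋖v))

lemma3p2 : {m n : ℕ} (Γ : Dynkin m) (P : FinPoset n) (κ : Fin n → Fin m) →
    IsDComplete Γ P κ → FinPoset.Connected P →
    FinPoset.ConnectedSub P (TopTree Γ P κ)
lemma3p2 Γ P κ D conn f (x₀ , Tx₀ , fx₀) (y₀ , Ty₀ , fy₀) =
  tops-split (connected⇒crossing-cover conn g (x₀ , trans (g-on-top-tree Tx₀) fx₀)
                                              (y₀ , trans (g-on-top-tree Ty₀) fy₀))
  where
  open FinPosetProperties P
  open TopTreeProperties Γ P κ D

  g : Fin _ → Bool
  g z = f (top (κ z))

  g-on-top-tree : ∀ {t} → TopTree Γ P κ t → g t ≡ f t
  g-on-top-tree {t} Tt = cong f (sym (max-in-color⇒top t Tt))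

  tops-split : CrossingCover g → SplittingPair (TopTree Γ P κ) f
  tops-split (u , v , u⋖v , gu≢gv) =
    split-pair (TopTree Γ P κ) f (top-max (κ u)) (top-max (κ v)) gu≢gv
               (cover⇒tops-comparable u⋖v)
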